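{- Let $d$ be a nonzero integer and let $Q_0 = d(u_0^2 - 3u_1^2) + 6u_2^2 + 6u_2u_3 - 6u_3u_4$ and $Q_\infty = -2du_0u_1 + u_2^2 - 2u_2u_4 - 3u_3^2 - u_4^2$. Then for every $b\in\mathbb{Z}_3$, the quadric $V(bQ_0+Q_\infty)\subset\mathbb{P}^4_{\mathbb{Q}_3}$ contains no $\mathbb{Q}_3$-rational line.
   Context: $u_0,\dots,u_4$ are coordinates on $\mathbb{P}^4$; $\mathbb{Z}_3,\mathbb{Q}_3$ are the $3$-adic integers and $3$-adic numbers. -}

module Defs where

open import Data.Nat using (ℕ; suc; _^_)
open import Data.Integer using (ℤ; +_; _+_; _*_; -_; _-_)
open import Data.Integer.Divisibility using (_∣_)
open import Data.Fin using (Fin; zero; suc)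
open import Data.Product using (Σ; _×_; ∃; ∃-syntax)
open import Relation.Nullary using (¬_)

-- 3-adic integers ℤ₃, presented as a setoid of coherent sequences of
-- integer representatives: x n represents the class of x in ℤ/3^n.

three^ : ℕ → ℤ
three^ n = + (3 ^ n)

Z3 : Set
Z3 = ℕ → ℤ

IsZ3 : Z3 → Set
IsZ3 x = ∀ n → three^ n ∣ (x (suc n) - x n)

_≈Z_ : Z3 → Z3 → Set
x ≈Z y = ∀ n → three^ n ∣ (x n - y n)

infix 4 _≈Z_ _≈_

_+Z_ _*Z_ : Z3 → Z3 → Z3
(x +Z y) n = x n + y n
(x *Z y) n = x n * y n

-Z_ : Z3 → Z3
(-Z x) n = - x n

ιZ : ℤ → Z3
ιZ c n = c

-- 3-adic numbers ℚ₃ = ℤ₃[1/3]: a pair (x , k) stands for x / 3^k.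

record Q3 : Set where
  constructor _/3^_
  field
    num : Z3
    exp : ℕ
open Q3 public

IsQ3 : Q3 → Set
IsQ3 q = IsZ3 (num q)

_≈_ : Q3 → Q3 → Set
q ≈ r = (num q *Z ιZ (three^ (exp r))) ≈Z (num r *Z ιZ (three^ (exp q)))

_+Q_ _*Q_ : Q3 → Q3 → Q3
q +Q r = ((num q *Z ιZ (three^ (exp r))) +Z (num r *Z ιZ (three^ (exp q))))
           /3^ (exp q Data.Nat.+ exp r)
q *Q r = (num q *Z num r) /3^ (exp q Data.Nat.+ exp r)

infixl 6 _+Q_
infixl 7 _*Q_

ofZ3 : Z3 → Q3
ofZ3 x = x /3^ 0

ofℤ : ℤ → Q3
ofℤ c = ofZ3 (ιZ c)

0Q : Q3
0Q = ofℤ (+ 0)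

Vec5 : Set
Vec5 = Fin 5 → Q3

u0 u1 u2 u3 u4 : Vec5 → Q3
u0 u = u zero
u1 u = u (suc zero)
u2 u = u (suc (suc zero))
u3 u = u (suc (suc (suc zero)))
u4 u = u (suc (suc (suc (suc zero))))

Q₀ : ℤ → Vec5 → Q3
Q₀ d u = ofℤ d *Q (u0 u *Q u0 u +Q ofℤ (- + 3) *Q u1 u *Q u1 u)
         +Q ofℤ (+ 6) *Q u2 u *Q u2 u
         +Q ofℤ (+ 6) *Q u2 u *Q u3 u
         +Q ofℤ (- + 6) *Q u3 u *Q u4 u

Q∞ : ℤ → Vec5 → Q3
Q∞ d u = ofℤ (- (+ 2 * d)) *Q u0 u *Q u1 u
         +Q u2 u *Q u2 u
         +Q ofℤ (- + 2) *Q u2 u *Q u4 u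
         +Q ofℤ (- + 3) *Q u3 u *Q u3 u
         +Q ofℤ (- + 1) *Q u4 u *Q u4 u

Pencil : ℤ → Z3 → Vec5 → Q3
Pencil d b u = ofZ3 b *Q Q₀ d u +Q Q∞ d u

IsVec5 : Vec5 → Set
IsVec5 v = ∀ i → IsQ3 (v i)

lin : Q3 → Vec5 → Q3 → Vec5 → Vec5
lin s v t w i = s *Q v i +Q t *Q w i

LinIndep : Vec5 → Vec5 → Set
LinIndep v w = ∀ s t → IsQ3 s → IsQ3 t →
  (∀ i → lin s v t w i ≈ 0Q) → (s ≈ 0Q) × (t ≈ 0Q)

ContainsRationalLine : (Vec5 → Q3) → Set
ContainsRationalLine F = Σ Vec5 λ v → Σ Vec5 λ w →
  IsVec5 v × IsVec5 w × LinIndep v w ×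
  (∀ s t → IsQ3 s → IsQ3 t → F (lin s v t w) ≈ 0Q)

-- Write bQ₀ + Q∞ = P(u₀, u₁) + R(u₂, u₃, u₄) with P = d(b u₀² - 2u₀u₁ - 3b u₁²).  Modulo 3, R reduces to
-- u₂² + u₂u₄ - u₄², which has no nontrivial zero, and descending from there shows that R is anisotropic over
-- ℚ₃.  Hence a plane L of zeros meets u₀ = u₁ = 0 only in 0, so the 2×2 minor D of L in the first two
-- coordinates is nonzero.  On the other hand 1 + 3b² is a square in ℤ₃, so P is split.  The points of L over
-- the two isotropic lines of P are zeros of R, hence have zero R-part; by linearity so does the point over
-- their sum, where P takes the value D²·d·(3-adic unit) ≠ 0.  Everything is run on integer representatives
-- modulo 3^n.
module Submission where

open import Defs
open import Data.Empty using (⊥-elim)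
open import Data.Fin using (Fin; zero; suc; toℕ; fromℕ<)
open import Data.Fin.Properties using (toℕ-fromℕ<)
open import Data.Integer as ℤ using (ℤ; +_; _+_; _*_; -_; _-_; NonZero)
import Data.Integer.Properties as ℤₚ
open import Data.Integer.Divisibility.Signed
  using (_∣_; divides; _∣?_; ∣ᵤ⇒∣; ∣⇒∣ᵤ; ∣-refl; ∣-trans; ∣m∣n⇒∣m+n; ∣m∣n⇒∣m-n; ∣m+n∣m⇒∣n; ∣m+n∣n⇒∣m; ∣m⇒∣-m;
         ∣n⇒∣m*n; ∣m⇒∣m*n; *-monoˡ-∣; *-cancelˡ-∣; *-cancelʳ-∣)
open import Data.Integer.DivMod using (_%ℕ_; _/ℕ_; n%ℕd<d; a≡a%ℕn+[a/ℕn]*n)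
open import Data.Integer.Tactic.RingSolver using (solve-∀)
open import Data.Nat as ℕ using (ℕ; zero; suc; _≤_; _^_)
import Data.Nat.Properties as ℕₚ
import Data.Nat.Divisibility as ℕᵈ
open import Data.Nat.Primality using (Prime; prime?; euclidsLemma; prime⇒nonZero)
open import Data.Product as Product using (Σ; ∃-syntax; _×_; _,_; proj₁; proj₂)
open import Data.Sum as Sum using (_⊎_; inj₁; inj₂)
open import Data.Unit using (tt)
open import Function using (_∘_)
open import Relation.Binary.PropositionalEquality
open import Relation.Nullary using (¬_; yes; no)
open import Relation.Nullary.Decidable using (False; toWitness; toWitnessFalse)

^-monoʳ-∣ : ∀ m {i j} → i ≤ j → m ^ i ℕᵈ.∣ m ^ j
^-monoʳ-∣ m {i} {j} i≤j = ℕᵈ.divides (m ^ (j ℕ.∸ i)) (begin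
  m ^ j                   ≡⟨ cong (m ^_) (ℕₚ.m+[n∸m]≡n i≤j) ⟨
  m ^ (i ℕ.+ (j ℕ.∸ i))   ≡⟨ ℕₚ.^-distribˡ-+-* m i (j ℕ.∸ i) ⟩
  m ^ i ℕ.* m ^ (j ℕ.∸ i) ≡⟨ ℕₚ.*-comm (m ^ i) _ ⟩
  m ^ (j ℕ.∸ i) ℕ.* m ^ i ∎)
  where open ≡-Reasoning

module _ {p : ℕ} (p-prime : Prime p) where

  private instance
    p≢0 : ℕ.NonZero p
    p≢0 = prime⇒nonZero p-prime

  p^k∣m*n⇒p^k∣n : ∀ k {m n} → ¬ p ℕᵈ.∣ m → p ^ k ℕᵈ.∣ m ℕ.* n → p ^ k ℕᵈ.∣ n
  p^k∣m*n⇒p^k∣n zero {n = n} _ _ = ℕᵈ.1∣ n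
  p^k∣m*n⇒p^k∣n (suc k) {m} {n} p∤m p^k+1∣mn
    with euclidsLemma m n p-prime (ℕᵈ.∣-trans (ℕᵈ.m∣m*n (p ^ k)) p^k+1∣mn)
  ... | inj₁ p∣m = ⊥-elim (p∤m p∣m)
  ... | inj₂ (ℕᵈ.divides n′ refl) =
    subst (p ^ suc k ℕᵈ.∣_) (ℕₚ.*-comm p n′)
      (ℕᵈ.*-monoʳ-∣ p (p^k∣m*n⇒p^k∣n k p∤m (ℕᵈ.*-cancelˡ-∣ p (subst (p ^ suc k ℕᵈ.∣_) regroup p^k+1∣mn))))
    where
    regroup : m ℕ.* (n′ ℕ.* p) ≡ p ℕ.* (m ℕ.* n′)
    regroup = trans (sym (ℕₚ.*-assoc m n′ p)) (ℕₚ.*-comm (m ℕ.* n′) p)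

  p^[i+j]∣m*n⇒p^i∣m⊎p^[1+j]∣n : ∀ i j {m n} → p ^ (i ℕ.+ j) ℕᵈ.∣ m ℕ.* n → p ^ i ℕᵈ.∣ m ⊎ p ^ suc j ℕᵈ.∣ n
  p^[i+j]∣m*n⇒p^i∣m⊎p^[1+j]∣n zero j {m} _ = inj₁ (ℕᵈ.1∣ m)
  p^[i+j]∣m*n⇒p^i∣m⊎p^[1+j]∣n (suc i) j {m} {n} p^[i+j]∣mn with p ℕᵈ.∣? m
  ... | no p∤m = inj₂ (p^k∣m*n⇒p^k∣n (suc j) p∤m (ℕᵈ.∣-trans (^-monoʳ-∣ p (ℕ.s≤s (ℕₚ.m≤n+m j i))) p^[i+j]∣mn))
  ... | yes (ℕᵈ.divides m′ refl) =
    Sum.map₁ (λ p^i∣m′ → subst (p ^ suc i ℕᵈ.∣_) (ℕₚ.*-comm p m′) (ℕᵈ.*-monoʳ-∣ p p^i∣m′))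
      (p^[i+j]∣m*n⇒p^i∣m⊎p^[1+j]∣n i j (ℕᵈ.*-cancelˡ-∣ p (subst (p ^ suc (i ℕ.+ j) ℕᵈ.∣_) regroup p^[i+j]∣mn)))
    where
    regroup : m′ ℕ.* p ℕ.* n ≡ p ℕ.* (m′ ℕ.* n)
    regroup = trans (cong (ℕ._* n) (ℕₚ.*-comm m′ p)) (ℕₚ.*-assoc p m′ n)

n<3^n : ∀ n → n ℕ.< 3 ^ n
n<3^n zero = ℕ.s≤s ℕ.z≤n
n<3^n (suc n) = ℕₚ.≤-<-trans (n<3^n n) (ℕₚ.^-monoʳ-< 3 (ℕ.s≤s (ℕ.s≤s ℕ.z≤n)) (ℕₚ.n<1+n n))

three^-+ : ∀ m n → three^ (m ℕ.+ n) ≡ three^ m * three^ n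
three^-+ m n = trans (cong +_ (ℕₚ.^-distribˡ-+-* 3 m n)) (ℤₚ.pos-* (3 ^ m) (3 ^ n))

three^-suc : ∀ k → three^ (suc k) ≡ three^ k * + 3
three^-suc k = trans (cong +_ (ℕₚ.*-comm 3 (3 ^ k))) (ℤₚ.pos-* (3 ^ k) 3)

three^-double-suc : ∀ k → three^ (suc k ℕ.+ suc k) ≡ three^ (k ℕ.+ k) * + 9
three^-double-suc k = trans (cong three^ (trans (cong suc (ℕₚ.+-suc k k)) (ℕₚ.+-comm 2 (k ℕ.+ k))))
                            (three^-+ (k ℕ.+ k) 2)

three^-mono-∣ : ∀ {m n} → m ≤ n → three^ m ∣ three^ n
three^-mono-∣ m≤n = ∣ᵤ⇒∣ (^-monoʳ-∣ 3 m≤n)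

three^-suc-∣ : ∀ k a → three^ k ∣ a → three^ (suc k) ∣ a * + 3
three^-suc-∣ k a three^k∣a = subst (_∣ _) (sym (three^-suc k)) (*-monoˡ-∣ (+ 3) three^k∣a)

three^≢0 : ∀ n → NonZero (three^ n)
three^≢0 n = ℕₚ.m^n≢0 3 n

3-prime : Prime 3
3-prime = toWitness {a? = prime? 3} tt

three^[i+j]∣x*y⇒three^i∣x⊎three^[1+j]∣y : ∀ i j {x y} → three^ (i ℕ.+ j) ∣ x * y →
  three^ i ∣ x ⊎ three^ (suc j) ∣ y
three^[i+j]∣x*y⇒three^i∣x⊎three^[1+j]∣y i j {x} {y} h = Sum.map ∣ᵤ⇒∣ ∣ᵤ⇒∣
  (p^[i+j]∣m*n⇒p^i∣m⊎p^[1+j]∣n 3-prime i j (subst (3 ^ (i ℕ.+ j) ℕᵈ.∣_) (ℤₚ.abs-* x y) (∣⇒∣ᵤ h)))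

three^k∣x*y⇒three^k∣y : ∀ k {x y} → ¬ + 3 ∣ x → three^ k ∣ x * y → three^ k ∣ y
three^k∣x*y⇒three^k∣y k {x} {y} 3∤x h = ∣ᵤ⇒∣
  (p^k∣m*n⇒p^k∣n 3-prime k (3∤x ∘ ∣ᵤ⇒∣) (subst (3 ^ k ℕᵈ.∣_) (ℤₚ.abs-* x y) (∣⇒∣ᵤ h)))

three^∣d∣∤d : ∀ {d} → d ≢ + 0 → ¬ three^ ℤ.∣ d ∣ ∣ d
three^∣d∣∤d {d} d≢0 three^∣d∣∣d =
  ℕₚ.<⇒≱ (n<3^n ℤ.∣ d ∣) (ℕᵈ.∣⇒≤ {{ℕ.≢-nonZero (d≢0 ∘ ℤₚ.∣i∣≡0⇒i≡0)}} (∣⇒∣ᵤ three^∣d∣∣d))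

3∤ : ∀ z → {False (+ 3 ∣? z)} → ¬ + 3 ∣ z
3∤ z {3∤z} = toWitnessFalse 3∤z

infix 4 _≡_[mod_]
record _≡_[mod_] (a b m : ℤ) : Set where
  constructor by-∣
  field ∣-difference : m ∣ a - b
open _≡_[mod_]

module _ {m : ℤ} where

  [mod]-refl : ∀ {a} → a ≡ a [mod m ]
  [mod]-refl {a} = by-∣ (subst (m ∣_) (sym (ℤₚ.+-inverseʳ a)) (divides (+ 0) refl))

  [mod]-trans : ∀ {a b c} → a ≡ b [mod m ] → b ≡ c [mod m ] → a ≡ c [mod m ]
  [mod]-trans {a} {b} {c} (by-∣ a≡b) (by-∣ b≡c) = by-∣ (subst (m ∣_) (split a b c) (∣m∣n⇒∣m+n a≡b b≡c))
    where
    split : ∀ a b c → (a - b) + (b - c) ≡ a - c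
    split = solve-∀

  +-cong-[mod] : ∀ {a a′ b b′} → a ≡ a′ [mod m ] → b ≡ b′ [mod m ] → a + b ≡ a′ + b′ [mod m ]
  +-cong-[mod] {a} {a′} {b} {b′} (by-∣ a≡a′) (by-∣ b≡b′) = by-∣ (subst (m ∣_) (split a a′ b b′) (∣m∣n⇒∣m+n a≡a′ b≡b′))
    where
    split : ∀ a a′ b b′ → (a - a′) + (b - b′) ≡ (a + b) - (a′ + b′)
    split = solve-∀

  *-cong-[mod] : ∀ {a a′ b b′} → a ≡ a′ [mod m ] → b ≡ b′ [mod m ] → a * b ≡ a′ * b′ [mod m ]
  *-cong-[mod] {a} {a′} {b} {b′} (by-∣ a≡a′) (by-∣ b≡b′) =
    by-∣ (subst (m ∣_) (split a a′ b b′) (∣m∣n⇒∣m+n (∣n⇒∣m*n a b≡b′) (∣m⇒∣m*n b′ a≡a′)))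
    where
    split : ∀ a a′ b b′ → a * (b - b′) + (a - a′) * b′ ≡ a * b - a′ * b′
    split = solve-∀

  -‿cong-[mod] : ∀ {a a′} → a ≡ a′ [mod m ] → - a ≡ - a′ [mod m ]
  -‿cong-[mod] {a} {a′} (by-∣ a≡a′) = by-∣ (subst (m ∣_) (split a a′) (∣m⇒∣-m a≡a′))
    where
    split : ∀ a a′ → - (a - a′) ≡ - a - - a′
    split = solve-∀

  ∣-resp-≡[mod] : ∀ {a b} → a ≡ b [mod m ] → m ∣ a → m ∣ b
  ∣-resp-≡[mod] {a} {b} (by-∣ a≡b) m∣a = subst (m ∣_) (cancel a b) (∣m∣n⇒∣m-n m∣a a≡b)
    where
    cancel : ∀ a b → a - (a - b) ≡ b
    cancel = solve-∀

[mod]-weaken : ∀ {k m a b} → k ∣ m → a ≡ b [mod m ] → a ≡ b [mod k ]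
[mod]-weaken k∣m (by-∣ m∣a-b) = by-∣ (∣-trans k∣m m∣a-b)

residue-mod-3 : ∀ x → Σ (Fin 3) λ r → x ≡ + toℕ r [mod + 3 ]
residue-mod-3 x = fromℕ< (n%ℕd<d x 3) , by-∣ (divides (x /ℕ 3) (begin
  x - + toℕ (fromℕ< (n%ℕd<d x 3))  ≡⟨ cong (λ r → x - + r) (toℕ-fromℕ< (n%ℕd<d x 3)) ⟩
  x - + (x %ℕ 3)                   ≡⟨ cong (_- + (x %ℕ 3)) (a≡a%ℕn+[a/ℕn]*n x 3) ⟩
  (+ (x %ℕ 3) + x /ℕ 3 * + 3) - + (x %ℕ 3) ≡⟨ cancel (+ (x %ℕ 3)) (x /ℕ 3 * + 3) ⟩
  x /ℕ 3 * + 3                     ∎))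
  where
  open ≡-Reasoning
  cancel : ∀ r y → (r + y) - r ≡ y
  cancel = solve-∀

-- IsZ3 repackaged as a record, so that the sequence can be inferred from a proof of coherence.
record Coherent (x : Z3) : Set where
  constructor coherent-by
  field coherent : ∀ n → x (suc n) ≡ x n [mod three^ n ]
open Coherent

IsZ3⇒Coherent : ∀ {x} → IsZ3 x → Coherent x
IsZ3⇒Coherent {x} x-coh = coherent-by λ n → by-∣ (∣ᵤ⇒∣ {three^ n} {x (suc n) - x n} (x-coh n))

Coherent⇒IsZ3 : ∀ {x} → Coherent x → IsZ3 x
Coherent⇒IsZ3 x-coh n = ∣⇒∣ᵤ (∣-difference (coherent x-coh n))

module _ {x : Z3} (x-coh : Coherent x) where

  coherent-≤ : ∀ {n m} → n ≤ m → x m ≡ x n [mod three^ n ]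
  coherent-≤ = go ∘ ℕₚ.≤⇒≤′
    where
    go : ∀ {n m} → n ℕ.≤′ m → x m ≡ x n [mod three^ n ]
    go ℕ.≤′-refl = [mod]-refl
    go (ℕ.≤′-step {m} n≤′m) = [mod]-trans ([mod]-weaken (three^-mono-∣ (ℕₚ.≤′⇒≤ n≤′m)) (coherent x-coh m)) (go n≤′m)

  ∣-coherent-down : ∀ {n m} → n ≤ m → three^ n ∣ x m → three^ n ∣ x n
  ∣-coherent-down n≤m = ∣-resp-≡[mod] (coherent-≤ n≤m)

+Z-coherent : ∀ {x y} → Coherent x → Coherent y → Coherent (x +Z y)
+Z-coherent x-coh y-coh = coherent-by λ n → +-cong-[mod] (coherent x-coh n) (coherent y-coh n)

*Z-coherent : ∀ {x y} → Coherent x → Coherent y → Coherent (x *Z y)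
*Z-coherent x-coh y-coh = coherent-by λ n → *-cong-[mod] (coherent x-coh n) (coherent y-coh n)

-Z-coherent : ∀ {x} → Coherent x → Coherent (-Z x)
-Z-coherent x-coh = coherent-by λ n → -‿cong-[mod] (coherent x-coh n)

ιZ-coherent : ∀ c → Coherent (ιZ c)
ιZ-coherent c = coherent-by λ n → [mod]-refl

+Q-coherent : ∀ q r → Coherent (num q) → Coherent (num r) → Coherent (num (q +Q r))
+Q-coherent q r q-coh r-coh =
  +Z-coherent (*Z-coherent q-coh (ιZ-coherent (three^ (exp r)))) (*Z-coherent r-coh (ιZ-coherent (three^ (exp q))))

combination : Z3 → (Fin 5 → Z3) → Z3 → (Fin 5 → Z3) → Fin 5 → Z3
combination S V T W i = (S *Z V i) +Z (T *Z W i)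

combination-coherent : ∀ {S V T W} → Coherent S → (∀ i → Coherent (V i)) → Coherent T → (∀ i → Coherent (W i)) →
  ∀ i → Coherent (combination S V T W i)
combination-coherent S-coh V-coh T-coh W-coh i = +Z-coherent (*Z-coherent S-coh (V-coh i)) (*Z-coherent T-coh (W-coh i))

record Vanishes (x : Z3) : Set where
  constructor vanishing
  field vanishes : ∀ n → three^ n ∣ x n
open Vanishes

vanishes-resp : ∀ {x y} → (∀ n → x n ≡ y n) → Vanishes y → Vanishes x
vanishes-resp x≡y y-vanishes = vanishing λ n → subst (three^ n ∣_) (sym (x≡y n)) (vanishes y-vanishes n)

-Z-vanishes : ∀ {x} → Vanishes (-Z x) → Vanishes x
-Z-vanishes {x} -x-vanishes = vanishing λ n →
  subst (three^ n ∣_) (ℤₚ.neg-involutive (x n)) (∣m⇒∣-m (vanishes -x-vanishes n))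

ιZ0-vanishes : Vanishes (ιZ (+ 0))
ιZ0-vanishes = vanishing λ n → divides (+ 0) refl

module _ (q : Q3) where

  private
    normalise : ∀ a k → a * + 1 - + 0 * k ≡ a
    normalise = solve-∀

  ≈0Q⇒vanishes : q ≈ 0Q → Vanishes (num q)
  ≈0Q⇒vanishes q≈0 = vanishing λ n → subst (three^ n ∣_) (normalise (num q n) (three^ (exp q))) (∣ᵤ⇒∣ (q≈0 n))

  vanishes⇒≈0Q : Vanishes (num q) → q ≈ 0Q
  vanishes⇒≈0Q q-vanishes n =
    ∣⇒∣ᵤ (subst (three^ n ∣_) (sym (normalise (num q n) (three^ (exp q)))) (vanishes q-vanishes n))

vanishes-by-rescaling : ∀ {x y} j k → Coherent x → Vanishes y → (∀ n → x n * three^ j ≡ y n * three^ k) → Vanishes x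
vanishes-by-rescaling {x} j k x-coh y-vanishes x≡y = vanishing λ n →
  ∣-coherent-down x-coh (ℕₚ.m≤m+n n j) (*-cancelʳ-∣ (three^ j) {three^ n} {x (n ℕ.+ j)} {{three^≢0 j}}
    (subst₂ _∣_ (three^-+ n j) (sym (x≡y (n ℕ.+ j))) (∣m⇒∣m*n (three^ k) (vanishes y-vanishes (n ℕ.+ j)))))

infix 4 _≅[_]_÷3^_
record _≅[_]_÷3^_ (q : Q3) (n : ℕ) (X : ℤ) (k : ℕ) : Set where
  constructor cross-multiply
  field cross-multiplied : num q n * three^ k ≡ X * three^ (exp q)
open _≅[_]_÷3^_

module _ {q r : Q3} {n : ℕ} {X Y : ℤ} where

  +Q-≅ : ∀ {k} → q ≅[ n ] X ÷3^ k → r ≅[ n ] Y ÷3^ k → q +Q r ≅[ n ] X + Y ÷3^ k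
  +Q-≅ {k} (cross-multiply q≅X) (cross-multiply r≅Y) = cross-multiply (begin
    (a * B + b * A) * K                ≡⟨ distrib a b A B K ⟩
    (a * K) * B + (b * K) * A          ≡⟨ cong₂ (λ u v → u * B + v * A) q≅X r≅Y ⟩
    (X * A) * B + (Y * B) * A          ≡⟨ collect X Y A B ⟩
    (X + Y) * (A * B)                  ≡⟨ cong ((X + Y) *_) (three^-+ (exp q) (exp r)) ⟨
    (X + Y) * three^ (exp q ℕ.+ exp r) ∎)
    where
    open ≡-Reasoning
    a b A B K : ℤ
    a = num q n
    b = num r n
    A = three^ (exp q)
    B = three^ (exp r)
    K = three^ k
    distrib : ∀ a b A B K → (a * B + b * A) * K ≡ (a * K) * B + (b * K) * A
    distrib = solve-∀
    collect : ∀ X Y A B → (X * A) * B + (Y * B) * A ≡ (X + Y) * (A * B)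
    collect = solve-∀

  *Q-≅ : ∀ {k l} → q ≅[ n ] X ÷3^ k → r ≅[ n ] Y ÷3^ l → q *Q r ≅[ n ] X * Y ÷3^ (k ℕ.+ l)
  *Q-≅ {k} {l} (cross-multiply q≅X) (cross-multiply r≅Y) = cross-multiply (begin
    (a * b) * three^ (k ℕ.+ l)         ≡⟨ cong ((a * b) *_) (three^-+ k l) ⟩
    (a * b) * (K * L)                  ≡⟨ interchange a b K L ⟩
    (a * K) * (b * L)                  ≡⟨ cong₂ _*_ q≅X r≅Y ⟩
    (X * A) * (Y * B)                  ≡⟨ interchange X Y A B ⟨
    (X * Y) * (A * B)                  ≡⟨ cong ((X * Y) *_) (three^-+ (exp q) (exp r)) ⟨
    (X * Y) * three^ (exp q ℕ.+ exp r) ∎)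
    where
    open ≡-Reasoning
    a b A B K L : ℤ
    a = num q n
    b = num r n
    A = three^ (exp q)
    B = three^ (exp r)
    K = three^ k
    L = three^ l
    interchange : ∀ a b K L → (a * b) * (K * L) ≡ (a * K) * (b * L)
    interchange = solve-∀

≅-exponent : ∀ {q n X k l} → k ≡ l → q ≅[ n ] X ÷3^ k → q ≅[ n ] X ÷3^ l
≅-exponent refl q≅X = q≅X

ofZ3-≅ : ∀ x n → ofZ3 x ≅[ n ] x n ÷3^ 0
ofZ3-≅ x n = cross-multiply refl

≅-common-exponent : ∀ q {E} → exp q ≤ E → ∀ n → q ≅[ n ] num q n * three^ (E ℕ.∸ exp q) ÷3^ E
≅-common-exponent q {E} e≤E n = cross-multiply (begin
  num q n * three^ E                                  ≡⟨ cong (λ m → num q n * three^ m) (ℕₚ.m∸n+n≡m e≤E) ⟨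
  num q n * three^ (E ℕ.∸ exp q ℕ.+ exp q)            ≡⟨ cong (num q n *_) (three^-+ (E ℕ.∸ exp q) (exp q)) ⟩
  num q n * (three^ (E ℕ.∸ exp q) * three^ (exp q))   ≡⟨ ℤₚ.*-assoc (num q n) _ _ ⟨
  num q n * three^ (E ℕ.∸ exp q) * three^ (exp q)     ∎)
  where open ≡-Reasoning

≅-vanishes : ∀ {q Y k} → Coherent Y → (∀ n → q ≅[ n ] Y n ÷3^ k) → q ≈ 0Q → Vanishes Y
≅-vanishes {q} {k = k} Y-coh q≅Y q≈0 =
  vanishes-by-rescaling (exp q) k Y-coh (≈0Q⇒vanishes q q≈0) (λ n → sym (cross-multiplied (q≅Y n)))

vanishes-≅ : ∀ {q Y k} → IsQ3 q → (∀ n → q ≅[ n ] Y n ÷3^ k) → Vanishes Y → q ≈ 0Q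
vanishes-≅ {q} {k = k} q-coh q≅Y Y-vanishes =
  vanishes⇒≈0Q q (vanishes-by-rescaling k (exp q) (IsZ3⇒Coherent q-coh) Y-vanishes (λ n → cross-multiplied (q≅Y n)))

-- Homogeneous forms of degree k in u₀, …, u₄ with coefficients in ℤ[b].  ⟦ pencil d ⟧ is Pencil d on the
-- nose, and ⟦_⟧ℤ evaluates on integer representatives at a single level.
data Form : ℕ → Set where
  var : Fin 5 → Form 1
  con : ℤ → Form 0
  par : Form 0
  _⊕_ : ∀ {k} → Form k → Form k → Form k
  _⊗_ : ∀ {j k} → Form j → Form k → Form (j ℕ.+ k)

infixl 6 _⊕_
infixl 7 _⊗_

⟦_⟧ : ∀ {k} → Form k → Z3 → Vec5 → Q3
⟦ var i ⟧ b u = u i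
⟦ con c ⟧ b u = ofℤ c
⟦ par ⟧ b u = ofZ3 b
⟦ f ⊕ g ⟧ b u = ⟦ f ⟧ b u +Q ⟦ g ⟧ b u
⟦ f ⊗ g ⟧ b u = ⟦ f ⟧ b u *Q ⟦ g ⟧ b u

⟦_⟧ℤ : ∀ {k} → Form k → ℤ → (Fin 5 → ℤ) → ℤ
⟦ var i ⟧ℤ β X = X i
⟦ con c ⟧ℤ β X = c
⟦ par ⟧ℤ β X = β
⟦ f ⊕ g ⟧ℤ β X = ⟦ f ⟧ℤ β X + ⟦ g ⟧ℤ β X
⟦ f ⊗ g ⟧ℤ β X = ⟦ f ⟧ℤ β X * ⟦ g ⟧ℤ β X

⟦⟧-≅ : ∀ {k} (f : Form k) b {u n X E} → (∀ i → u i ≅[ n ] X i ÷3^ E) →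
  ⟦ f ⟧ b u ≅[ n ] ⟦ f ⟧ℤ (b n) X ÷3^ (k ℕ.* E)
⟦⟧-≅ (var i) b {E = E} u≅X = ≅-exponent (sym (ℕₚ.+-identityʳ E)) (u≅X i)
⟦⟧-≅ (con c) b u≅X = cross-multiply refl
⟦⟧-≅ par b u≅X = cross-multiply refl
⟦⟧-≅ (f ⊕ g) b u≅X = +Q-≅ (⟦⟧-≅ f b u≅X) (⟦⟧-≅ g b u≅X)
⟦⟧-≅ (_⊗_ {j} {k} f g) b {E = E} u≅X =
  ≅-exponent (sym (ℕₚ.*-distribʳ-+ E j k)) (*Q-≅ (⟦⟧-≅ f b u≅X) (⟦⟧-≅ g b u≅X))

⟦⟧ℤ-cong : ∀ {k} (f : Form k) {m β β′ X Y} → β ≡ β′ [mod m ] → (∀ i → X i ≡ Y i [mod m ]) →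
  ⟦ f ⟧ℤ β X ≡ ⟦ f ⟧ℤ β′ Y [mod m ]
⟦⟧ℤ-cong (var i) β≡β′ X≡Y = X≡Y i
⟦⟧ℤ-cong (con c) β≡β′ X≡Y = [mod]-refl
⟦⟧ℤ-cong par β≡β′ X≡Y = β≡β′
⟦⟧ℤ-cong (f ⊕ g) β≡β′ X≡Y = +-cong-[mod] (⟦⟧ℤ-cong f β≡β′ X≡Y) (⟦⟧ℤ-cong g β≡β′ X≡Y)
⟦⟧ℤ-cong (f ⊗ g) β≡β′ X≡Y = *-cong-[mod] (⟦⟧ℤ-cong f β≡β′ X≡Y) (⟦⟧ℤ-cong g β≡β′ X≡Y)

⟦⟧ℤ-coherent : ∀ {k} (f : Form k) {b} {X : Fin 5 → Z3} → Coherent b → (∀ i → Coherent (X i)) →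
  Coherent (λ n → ⟦ f ⟧ℤ (b n) (λ i → X i n))
⟦⟧ℤ-coherent f b-coh X-coh = coherent-by λ n → ⟦⟧ℤ-cong f (coherent b-coh n) (λ i → coherent (X-coh i) n)

f0 f1 f2 f3 f4 : Fin 5
f0 = zero
f1 = suc zero
f2 = suc (suc zero)
f3 = suc (suc (suc zero))
f4 = suc (suc (suc (suc zero)))

pencil : ℤ → Form 2
pencil d = par ⊗ (con d ⊗ (var f0 ⊗ var f0 ⊕ con (- + 3) ⊗ var f1 ⊗ var f1)
                  ⊕ con (+ 6) ⊗ var f2 ⊗ var f2
                  ⊕ con (+ 6) ⊗ var f2 ⊗ var f3
                  ⊕ con (- + 6) ⊗ var f3 ⊗ var f4)
           ⊕ (con (- (+ 2 * d)) ⊗ var f0 ⊗ var f1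
              ⊕ var f2 ⊗ var f2
              ⊕ con (- + 2) ⊗ var f2 ⊗ var f4
              ⊕ con (- + 3) ⊗ var f3 ⊗ var f3
              ⊕ con (- + 1) ⊗ var f4 ⊗ var f4)

-- solve-∀ does not unfold P and R, so the ring identities about them below are stated on their bodies.
P : ℤ → ℤ → ℤ → ℤ → ℤ
P d β x y = d * (β * (x * x - + 3 * y * y) - + 2 * x * y)

R : ℤ → ℤ → ℤ → ℤ → ℤ
R β x y z = β * (+ 6 * x * x + + 6 * x * y - + 6 * y * z) + x * x - + 2 * x * z - + 3 * y * y - z * z

pencil-split : ∀ d β X → ⟦ pencil d ⟧ℤ β X ≡ P d β (X f0) (X f1) + R β (X f2) (X f3) (X f4)
pencil-split d β X = split d β (X f0) (X f1) (X f2) (X f3) (X f4)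
  where
  split : ∀ d β x₀ x₁ x₂ x₃ x₄ →
    β * (d * (x₀ * x₀ + - + 3 * x₁ * x₁) + + 6 * x₂ * x₂ + + 6 * x₂ * x₃ + - + 6 * x₃ * x₄)
      + (- (+ 2 * d) * x₀ * x₁ + x₂ * x₂ + - + 2 * x₂ * x₄ + - + 3 * x₃ * x₃ + - + 1 * x₄ * x₄)
    ≡ d * (β * (x₀ * x₀ - + 3 * x₁ * x₁) - + 2 * x₀ * x₁)
      + (β * (+ 6 * x₂ * x₂ + + 6 * x₂ * x₃ - + 6 * x₃ * x₄) + x₂ * x₂ - + 2 * x₂ * x₄ - + 3 * x₃ * x₃ - x₄ * x₄)
  split = solve-∀

P-homogeneous : ∀ d β m x y → P d β (m * x) (m * y) ≡ m * m * P d β x y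
P-homogeneous = expand
  where
  expand : ∀ d β m x y → d * (β * (m * x * (m * x) - + 3 * (m * y) * (m * y)) - + 2 * (m * x) * (m * y))
                         ≡ m * m * (d * (β * (x * x - + 3 * y * y) - + 2 * x * y))
  expand = solve-∀

R-homogeneous : ∀ β m x y z → R β (x * m) (y * m) (z * m) ≡ R β x y z * (m * m)
R-homogeneous = expand
  where
  expand : ∀ β m x y z →
    β * (+ 6 * (x * m) * (x * m) + + 6 * (x * m) * (y * m) - + 6 * (y * m) * (z * m))
      + (x * m) * (x * m) - + 2 * (x * m) * (z * m) - + 3 * (y * m) * (y * m) - (z * m) * (z * m)
    ≡ (β * (+ 6 * x * x + + 6 * x * y - + 6 * y * z) + x * x - + 2 * x * z - + 3 * y * y - z * z) * (m * m)
  expand = solve-∀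

_∣tail_ : ℤ → (Fin 5 → ℤ) → Set
m ∣tail X = m ∣ X f2 × m ∣ X f3 × m ∣ X f4

P-∣ : ∀ {m} d β {x y} → m ∣ x → m ∣ y → m ∣ P d β x y
P-∣ d β {x} {y} m∣x m∣y = ∣n⇒∣m*n d (∣m∣n⇒∣m-n (∣n⇒∣m*n β (∣m∣n⇒∣m-n (∣m⇒∣m*n x m∣x) (∣n⇒∣m*n (+ 3 * y) m∣y)))
                                                (∣n⇒∣m*n (+ 2 * x) m∣y))

R-∣ : ∀ {m} β {x y z} → m ∣ x → m ∣ y → m ∣ z → m * m ∣ R β x y z
R-∣ {m} β (divides x refl) (divides y refl) (divides z refl) =
  subst (m * m ∣_) (sym (R-homogeneous β m x y z)) (∣n⇒∣m*n (R β x y z) ∣-refl)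

module _ {m} d β (X : Fin 5 → ℤ) (m∣F : m ∣ ⟦ pencil d ⟧ℤ β X) where

  pencil-∣P⇒∣R : m ∣ P d β (X f0) (X f1) → m ∣ R β (X f2) (X f3) (X f4)
  pencil-∣P⇒∣R = ∣m+n∣m⇒∣n (subst (m ∣_) (pencil-split d β X) m∣F)

  pencil-∣R⇒∣P : m ∣ R β (X f2) (X f3) (X f4) → m ∣ P d β (X f0) (X f1)
  pencil-∣R⇒∣P = ∣m+n∣n⇒∣m (subst (m ∣_) (pencil-split d β X) m∣F)

x²+xy-y²-anisotropic-mod-3 : ∀ {x y} → + 3 ∣ x * x + x * y - y * y → + 3 ∣ x × + 3 ∣ y
x²+xy-y²-anisotropic-mod-3 {x} {y} 3∣g with residue-mod-3 x | residue-mod-3 y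
... | r , x≡r | s , y≡s =
  conclude r s (∣-resp-≡[mod] (+-cong-[mod] (+-cong-[mod] (*-cong-[mod] x≡r x≡r) (*-cong-[mod] x≡r y≡s))
                                           (-‿cong-[mod] (*-cong-[mod] y≡s y≡s))) 3∣g) x≡r y≡s
  where
  3∣_by_ : ∀ a → a ≡ + 0 [mod + 3 ] → + 3 ∣ a
  3∣ a by a≡0 = subst (+ 3 ∣_) (ℤₚ.+-identityʳ a) (∣-difference a≡0)
  conclude : ∀ r s → + 3 ∣ + toℕ r * + toℕ r + + toℕ r * + toℕ s - + toℕ s * + toℕ s →
             x ≡ + toℕ r [mod + 3 ] → y ≡ + toℕ s [mod + 3 ] → + 3 ∣ x × + 3 ∣ y
  conclude zero zero _ x≡0 y≡0 = 3∣ x by x≡0 , 3∣ y by y≡0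
  conclude zero (suc zero) h = ⊥-elim (3∤ _ h)
  conclude zero (suc (suc zero)) h = ⊥-elim (3∤ _ h)
  conclude (suc zero) zero h = ⊥-elim (3∤ _ h)
  conclude (suc zero) (suc zero) h = ⊥-elim (3∤ _ h)
  conclude (suc zero) (suc (suc zero)) h = ⊥-elim (3∤ _ h)
  conclude (suc (suc zero)) zero h = ⊥-elim (3∤ _ h)
  conclude (suc (suc zero)) (suc zero) h = ⊥-elim (3∤ _ h)
  conclude (suc (suc zero)) (suc (suc zero)) h = ⊥-elim (3∤ _ h)

3∣x*x⇒3∣x : ∀ {x} → + 3 ∣ x * x → + 3 ∣ x
3∣x*x⇒3∣x 3∣x² = Sum.reduce (three^[i+j]∣x*y⇒three^i∣x⊎three^[1+j]∣y 1 0 3∣x²)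

R-anisotropic-mod-9 : ∀ β x y z → + 9 ∣ R β x y z → + 3 ∣ x × + 3 ∣ y × + 3 ∣ z
R-anisotropic-mod-9 β x y z 9∣R = descend (x²+xy-y²-anisotropic-mod-3 3∣g) 9∣R
  where
  reduce-mod-3 : ∀ β x y z →
    (β * (+ 6 * x * x + + 6 * x * y - + 6 * y * z) + x * x - + 2 * x * z - + 3 * y * y - z * z)
      - + 3 * (+ 2 * β * x * x + + 2 * β * x * y - + 2 * β * y * z - x * z - y * y)
    ≡ x * x + x * z - z * z
  reduce-mod-3 = solve-∀
  q : ℤ
  q = + 2 * β * x * x + + 2 * β * x * y - + 2 * β * y * z - x * z - y * y
  3∣g : + 3 ∣ x * x + x * z - z * z
  3∣g = subst (+ 3 ∣_) (reduce-mod-3 β x y z)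
    (∣m∣n⇒∣m-n {+ 3} {R β x y z} {+ 3 * q} (∣-trans (divides (+ 3) refl) 9∣R) (∣m⇒∣m*n q ∣-refl))
  descend : ∀ {x z} → + 3 ∣ x × + 3 ∣ z → + 9 ∣ R β x y z → + 3 ∣ x × + 3 ∣ y × + 3 ∣ z
  descend (3∣x@(divides a refl) , 3∣z@(divides c refl)) 9∣R[3a,y,3c] =
    3∣x , 3∣x*x⇒3∣x (*-cancelˡ-∣ (+ 3) 9∣3y²) , 3∣z
    where
    reduce-mod-9 : ∀ β a y c →
      (+ 6 * β * a * a + + 2 * β * a * y - + 2 * β * y * c + a * a - + 2 * a * c - c * c) * + 9
        - (β * (+ 6 * (a * + 3) * (a * + 3) + + 6 * (a * + 3) * y - + 6 * y * (c * + 3))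
           + (a * + 3) * (a * + 3) - + 2 * (a * + 3) * (c * + 3) - + 3 * y * y - (c * + 3) * (c * + 3))
      ≡ + 3 * (y * y)
    reduce-mod-9 = solve-∀
    q′ : ℤ
    q′ = + 6 * β * a * a + + 2 * β * a * y - + 2 * β * y * c + a * a - + 2 * a * c - c * c
    9∣3y² : + 9 ∣ + 3 * (y * y)
    9∣3y² = subst (+ 9 ∣_) (reduce-mod-9 β a y c)
      (∣m∣n⇒∣m-n {+ 9} {q′ * + 9} {R β (a * + 3) y (c * + 3)} (∣n⇒∣m*n q′ ∣-refl) 9∣R[3a,y,3c])

R-anisotropic : ∀ k β x y z → three^ (k ℕ.+ k) ∣ R β x y z → three^ k ∣ x × three^ k ∣ y × three^ k ∣ z
R-anisotropic zero _ _ _ _ _ = ∣ᵤ⇒∣ (ℕᵈ.1∣ _) , ∣ᵤ⇒∣ (ℕᵈ.1∣ _) , ∣ᵤ⇒∣ (ℕᵈ.1∣ _)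
R-anisotropic (suc k) β x y z three^[2k+2]∣R = descend (R-anisotropic-mod-9 β x y z 9∣R) three^[2k+2]∣R
  where
  9∣R : + 9 ∣ R β x y z
  9∣R = ∣-trans (three^-mono-∣ {2} {suc k ℕ.+ suc k} (ℕₚ.+-mono-≤ {1} {suc k} {1} {suc k} (ℕ.s≤s ℕ.z≤n) (ℕ.s≤s ℕ.z≤n)))
                three^[2k+2]∣R
  descend : ∀ {x y z} → + 3 ∣ x × + 3 ∣ y × + 3 ∣ z → three^ (suc k ℕ.+ suc k) ∣ R β x y z →
    three^ (suc k) ∣ x × three^ (suc k) ∣ y × three^ (suc k) ∣ z
  descend (divides a refl , divides b refl , divides c refl) three^[2k+2]∣R[3a,3b,3c] =
    Product.map (three^-suc-∣ k a) (Product.map (three^-suc-∣ k b) (three^-suc-∣ k c))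
      (R-anisotropic k β a b c (*-cancelʳ-∣ (+ 9) {three^ (k ℕ.+ k)} {R β a b c}
        (subst₂ _∣_ (three^-double-suc k) (R-homogeneous β (+ 3) a b c) three^[2k+2]∣R[3a,3b,3c])))

-- Newton step: if the defect is m·3^(N+1), replacing w by w + m·3^N changes it by 6m·3^N(1 + 3w) ≡ 2m·3^(N+1)
-- modulo 3^(N+2), which cancels it.
√[1+3β²]-mod-three^ : ∀ N β → ∃[ w ] three^ (suc N) ∣ (+ 1 + + 3 * w) * (+ 1 + + 3 * w) - (+ 1 + + 3 * β * β)
√[1+3β²]-mod-three^ zero β = + 0 , divides (- (β * β)) (base β)
  where
  base : ∀ β → (+ 1 + + 3 * + 0) * (+ 1 + + 3 * + 0) - (+ 1 + + 3 * β * β) ≡ - (β * β) * + 3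
  base = solve-∀
√[1+3β²]-mod-three^ (suc N) β with √[1+3β²]-mod-three^ N β
... | w , divides m E≡m*three^[1+N] = w + m * T , divides (m * (+ 1 + + 2 * w + m * T)) (begin
  E (w + m * T)                                 ≡⟨ expand β T w m ⟩
  E w + Δ                                       ≡⟨ cong (_+ Δ) (trans E≡m*three^[1+N] (cong (m *_) (three^-suc N))) ⟩
  m * (T * + 3) + Δ                             ≡⟨ collect T w m ⟩
  m * (+ 1 + + 2 * w + m * T) * (T * + 3 * + 3) ≡⟨ cong (m * (+ 1 + + 2 * w + m * T) *_) three^[2+N] ⟨
  m * (+ 1 + + 2 * w + m * T) * three^ (suc (suc N)) ∎)
  where
  open ≡-Reasoning
  T Δ : ℤ
  T = three^ N
  E : ℤ → ℤ
  E w = (+ 1 + + 3 * w) * (+ 1 + + 3 * w) - (+ 1 + + 3 * β * β)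
  Δ = + 3 * m * T * (+ 2 + + 6 * w + + 3 * m * T)
  expand : ∀ β T w m → (+ 1 + + 3 * (w + m * T)) * (+ 1 + + 3 * (w + m * T)) - (+ 1 + + 3 * β * β)
                       ≡ (+ 1 + + 3 * w) * (+ 1 + + 3 * w) - (+ 1 + + 3 * β * β)
                         + + 3 * m * T * (+ 2 + + 6 * w + + 3 * m * T)
  expand = solve-∀
  collect : ∀ T w m → m * (T * + 3) + + 3 * m * T * (+ 2 + + 6 * w + + 3 * m * T)
                      ≡ m * (+ 1 + + 2 * w + m * T) * (T * + 3 * + 3)
  collect = solve-∀
  three^[2+N] : three^ (suc (suc N)) ≡ T * + 3 * + 3
  three^[2+N] = trans (three^-suc (suc N)) (cong (_* + 3) (three^-suc N))

span : (Fin 5 → ℤ) → (Fin 5 → ℤ) → ℤ → ℤ → Fin 5 → ℤ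
span a c s t i = s * a i + t * c i

module _ (a c : Fin 5 → ℤ) where

  minor : ℤ
  minor = a f0 * c f1 - a f1 * c f0

  through : ℤ → ℤ → Fin 5 → ℤ
  through y₀ y₁ = span a c (y₀ * c f1 - y₁ * c f0) (y₁ * a f0 - y₀ * a f1)

  through-head : ∀ y₀ y₁ → through y₀ y₁ f0 ≡ minor * y₀ × through y₀ y₁ f1 ≡ minor * y₁
  through-head y₀ y₁ = adjugate₀ (a f0) (a f1) (c f0) (c f1) y₀ y₁ , adjugate₁ (a f0) (a f1) (c f0) (c f1) y₀ y₁
    where
    adjugate₀ : ∀ a₀ a₁ c₀ c₁ y₀ y₁ → (y₀ * c₁ - y₁ * c₀) * a₀ + (y₁ * a₀ - y₀ * a₁) * c₀ ≡ (a₀ * c₁ - a₁ * c₀) * y₀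
    adjugate₀ = solve-∀
    adjugate₁ : ∀ a₀ a₁ c₀ c₁ y₀ y₁ → (y₀ * c₁ - y₁ * c₀) * a₁ + (y₁ * a₀ - y₀ * a₁) * c₁ ≡ (a₀ * c₁ - a₁ * c₀) * y₁
    adjugate₁ = solve-∀

  through-+ : ∀ y₀ y₁ z₀ z₁ i → through (y₀ + z₀) (y₁ + z₁) i ≡ through y₀ y₁ i + through z₀ z₁ i
  through-+ y₀ y₁ z₀ z₁ i = linear y₀ y₁ z₀ z₁ (a f0) (a f1) (c f0) (c f1) (a i) (c i)
    where
    linear : ∀ y₀ y₁ z₀ z₁ a₀ a₁ c₀ c₁ aᵢ cᵢ →
      ((y₀ + z₀) * c₁ - (y₁ + z₁) * c₀) * aᵢ + ((y₁ + z₁) * a₀ - (y₀ + z₀) * a₁) * cᵢ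
      ≡ ((y₀ * c₁ - y₁ * c₀) * aᵢ + (y₁ * a₀ - y₀ * a₁) * cᵢ) + ((z₀ * c₁ - z₁ * c₀) * aᵢ + (z₁ * a₀ - z₀ * a₁) * cᵢ)
    linear = solve-∀

-- With (1 + 3w)² ≡ 1 + 3β² and ρ = 2 + 3w, the vectors e = (ρ , β) and f = (3β , -ρ) are isotropic for P,
-- and P(e + f) = 4ρ(1 + 3β²)·d, where 4ρ(1 + 3β²) is prime to 3.
module _ (k : ℕ) (d β : ℤ) (a c : Fin 5 → ℤ)
         (isotropic : ∀ s t → three^ (k ℕ.+ k) ∣ ⟦ pencil d ⟧ℤ β (span a c s t)) where

  private
    N : ℕ
    N = k ℕ.+ k
    D w ρ E u : ℤ
    D = minor a c
    w = proj₁ (√[1+3β²]-mod-three^ N β)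
    ρ = + 2 + + 3 * w
    E = (+ 1 + + 3 * w) * (+ 1 + + 3 * w) - (+ 1 + + 3 * β * β)
    u = + 4 * ρ * (+ 1 + + 3 * β * β)

    three^N∣E : three^ N ∣ E
    three^N∣E = ∣-trans (three^-mono-∣ (ℕₚ.n≤1+n N)) (proj₂ (√[1+3β²]-mod-three^ N β))

    3∤u : ¬ + 3 ∣ u
    3∤u 3∣u = 3∤ (+ 2) (∣m+n∣n⇒∣m {+ 3} {+ 2} {+ 3 * Z} (subst (+ 3 ∣_) (u≡2+3Z w β) 3∣u) (∣m⇒∣m*n Z ∣-refl))
      where
      Z : ℤ
      Z = + 2 + + 4 * w + + 8 * β * β + + 12 * w * β * β
      u≡2+3Z : ∀ w β → + 4 * (+ 2 + + 3 * w) * (+ 1 + + 3 * β * β)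
                       ≡ + 2 + + 3 * (+ 2 + + 4 * w + + 8 * β * β + + 12 * w * β * β)
      u≡2+3Z = solve-∀

    P-through : ∀ y₀ y₁ → P d β (through a c y₀ y₁ f0) (through a c y₀ y₁ f1) ≡ D * D * P d β y₀ y₁
    P-through y₀ y₁ = trans (cong₂ (P d β) (proj₁ (through-head a c y₀ y₁)) (proj₂ (through-head a c y₀ y₁)))
                            (P-homogeneous d β D y₀ y₁)

    on-quadric : ∀ y₀ y₁ → three^ N ∣ ⟦ pencil d ⟧ℤ β (through a c y₀ y₁)
    on-quadric y₀ y₁ = isotropic (y₀ * c f1 - y₁ * c f0) (y₁ * a f0 - y₀ * a f1)

    tail-divisible : ∀ y₀ y₁ → three^ N ∣ P d β y₀ y₁ → three^ k ∣tail through a c y₀ y₁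
    tail-divisible y₀ y₁ h = R-anisotropic k β (through a c y₀ y₁ f2) (through a c y₀ y₁ f3) (through a c y₀ y₁ f4)
      (pencil-∣P⇒∣R d β (through a c y₀ y₁) (on-quadric y₀ y₁)
        (subst (three^ N ∣_) (sym (P-through y₀ y₁)) (∣n⇒∣m*n (D * D) h)))

    e-isotropic : three^ N ∣ P d β ρ β
    e-isotropic = subst (three^ N ∣_) (sym (P[e] d β w)) (∣n⇒∣m*n (d * β) three^N∣E)
      where
      P[e] : ∀ d β w → d * (β * ((+ 2 + + 3 * w) * (+ 2 + + 3 * w) - + 3 * β * β) - + 2 * (+ 2 + + 3 * w) * β)
                       ≡ d * β * ((+ 1 + + 3 * w) * (+ 1 + + 3 * w) - (+ 1 + + 3 * β * β))
      P[e] = solve-∀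

    f-isotropic : three^ N ∣ P d β (+ 3 * β) (- ρ)
    f-isotropic = subst (three^ N ∣_) (sym (P[f] d β w)) (∣n⇒∣m*n (- + 3 * d * β) three^N∣E)
      where
      P[f] : ∀ d β w →
        d * (β * (+ 3 * β * (+ 3 * β) - + 3 * - (+ 2 + + 3 * w) * - (+ 2 + + 3 * w)) - + 2 * (+ 3 * β) * - (+ 2 + + 3 * w))
        ≡ - + 3 * d * β * ((+ 1 + + 3 * w) * (+ 1 + + 3 * w) - (+ 1 + + 3 * β * β))
      P[f] = solve-∀

    e+f : Fin 5 → ℤ
    e+f = through a c (ρ + + 3 * β) (β - ρ)

    tail-e+f : ∀ i → three^ k ∣ through a c ρ β i → three^ k ∣ through a c (+ 3 * β) (- ρ) i → three^ k ∣ e+f i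
    tail-e+f i h₁ h₂ = subst (three^ k ∣_) (sym (through-+ a c ρ β (+ 3 * β) (- ρ) i)) (∣m∣n⇒∣m+n h₁ h₂)

    three^N∣R[e+f] : three^ N ∣ R β (e+f f2) (e+f f3) (e+f f4)
    three^N∣R[e+f] = combine (tail-divisible ρ β e-isotropic) (tail-divisible (+ 3 * β) (- ρ) f-isotropic)
      where
      combine : three^ k ∣tail through a c ρ β → three^ k ∣tail through a c (+ 3 * β) (- ρ) →
        three^ N ∣ R β (e+f f2) (e+f f3) (e+f f4)
      combine (e₂ , e₃ , e₄) (f₂ , f₃ , f₄) =
        subst (_∣ R β (e+f f2) (e+f f3) (e+f f4)) (sym (three^-+ k k))
          (R-∣ β (tail-e+f f2 e₂ f₂) (tail-e+f f3 e₃ f₃) (tail-e+f f4 e₄ f₄))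

    three^N∣u*D²d : three^ N ∣ u * (D * D * d)
    three^N∣u*D²d = subst (three^ N ∣_) (P[e+f] D d β w)
      (∣m∣n⇒∣m-n (subst (three^ N ∣_) (P-through (ρ + + 3 * β) (β - ρ))
                    (pencil-∣R⇒∣P d β e+f (on-quadric (ρ + + 3 * β) (β - ρ)) three^N∣R[e+f]))
                 (∣n⇒∣m*n (D * D * d * (+ 2 * (+ 1 - β))) three^N∣E))
      where
      P[e+f] : ∀ D d β w →
        D * D * (d * (β * ((+ 2 + + 3 * w + + 3 * β) * (+ 2 + + 3 * w + + 3 * β)
                          - + 3 * (β - (+ 2 + + 3 * w)) * (β - (+ 2 + + 3 * w)))
                      - + 2 * (+ 2 + + 3 * w + + 3 * β) * (β - (+ 2 + + 3 * w))))
          - D * D * d * (+ 2 * (+ 1 - β)) * ((+ 1 + + 3 * w) * (+ 1 + + 3 * w) - (+ 1 + + 3 * β * β))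
        ≡ + 4 * (+ 2 + + 3 * w) * (+ 1 + + 3 * β * β) * (D * D * d)
      P[e+f] = solve-∀

  isotropic-plane-mod-three^ : three^ (k ℕ.+ k) ∣ minor a c * minor a c * d
  isotropic-plane-mod-three^ = three^k∣x*y⇒three^k∣y N 3∤u three^N∣u*D²d

at : ℕ → (Fin 5 → Z3) → Fin 5 → ℤ
at n X i = X i n

-- The ℤ₃-lattice of a ℚ₃-rational line of V(bQ₀ + Q∞), once denominators are cleared.
record IntegralIsotropicPlane (d : ℤ) (b : Z3) : Set where
  field
    V W : Fin 5 → Z3
    V-coherent : ∀ i → Coherent (V i)
    W-coherent : ∀ i → Coherent (W i)
    isotropic : ∀ {S T} → Coherent S → Coherent T →
      Vanishes (λ n → ⟦ pencil d ⟧ℤ (b n) (span (at n V) (at n W) (S n) (T n)))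
    independent : ∀ {S T} → Coherent S → Coherent T → (∀ i → Vanishes (combination S V T W i)) →
      Vanishes S × Vanishes T

module _ {d b} (plane : IntegralIsotropicPlane d b) where
  open IntegralIsotropicPlane plane

  vanishing-head⇒vanishing-coefficients : ∀ {S T} → Coherent S → Coherent T →
    Vanishes (combination S V T W f0) → Vanishes (combination S V T W f1) → Vanishes S × Vanishes T
  vanishing-head⇒vanishing-coefficients {S} {T} S-coh T-coh X₀-vanishes X₁-vanishes =
    independent S-coh T-coh X-vanishes
    where
    X : Fin 5 → Z3
    X = combination S V T W
    X-coh : ∀ i → Coherent (X i)
    X-coh = combination-coherent S-coh V-coherent T-coh W-coherent
    tail-divisible : ∀ n → three^ n ∣tail at (n ℕ.+ n) X
    tail-divisible n = R-anisotropic n (b m) (X f2 m) (X f3 m) (X f4 m)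
      (pencil-∣P⇒∣R d (b m) (at m X) (vanishes (isotropic S-coh T-coh) m)
                    (P-∣ d (b m) (vanishes X₀-vanishes m) (vanishes X₁-vanishes m)))
      where
      m : ℕ
      m = n ℕ.+ n
    down : ∀ i → (∀ n → three^ n ∣ X i (n ℕ.+ n)) → Vanishes (X i)
    down i h = vanishing λ n → ∣-coherent-down (X-coh i) (ℕₚ.m≤m+n n n) (h n)
    X-vanishes : ∀ i → Vanishes (X i)
    X-vanishes zero = X₀-vanishes
    X-vanishes (suc zero) = X₁-vanishes
    X-vanishes (suc (suc zero)) = down f2 (proj₁ ∘ tail-divisible)
    X-vanishes (suc (suc (suc zero))) = down f3 (proj₁ ∘ proj₂ ∘ tail-divisible)
    X-vanishes (suc (suc (suc (suc zero)))) = down f4 (proj₂ ∘ proj₂ ∘ tail-divisible)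

  minorZ : Z3
  minorZ = (V f0 *Z W f1) +Z (-Z (V f1 *Z W f0))

  -- If D vanishes, the combinations W₀·V - V₀·W and W₁·V - V₁·W have vanishing head, so V₀ and V₁ vanish,
  -- and then the head of V itself vanishes.
  minorZ-not-vanishing : ¬ Vanishes minorZ
  minorZ-not-vanishing D-vanishes = 3∤ (+ 1) (vanishes (proj₁ trivial-combination) 1)
    where
    V₀-vanishes : Vanishes (V f0)
    V₀-vanishes = -Z-vanishes (proj₂ (vanishing-head⇒vanishing-coefficients (W-coherent f0) (-Z-coherent (V-coherent f0))
      (vanishes-resp (λ n → cancel (V f0 n) (W f0 n)) ιZ0-vanishes)
      (vanishes-resp (λ n → -minor (V f0 n) (V f1 n) (W f0 n) (W f1 n)) (vanishing λ n → ∣m⇒∣-m (vanishes D-vanishes n)))))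
      where
      cancel : ∀ v₀ w₀ → w₀ * v₀ + - v₀ * w₀ ≡ + 0
      cancel = solve-∀
      -minor : ∀ v₀ v₁ w₀ w₁ → w₀ * v₁ + - v₀ * w₁ ≡ - (v₀ * w₁ + - (v₁ * w₀))
      -minor = solve-∀
    V₁-vanishes : Vanishes (V f1)
    V₁-vanishes = -Z-vanishes (proj₂ (vanishing-head⇒vanishing-coefficients (W-coherent f1) (-Z-coherent (V-coherent f1))
      (vanishes-resp (λ n → minor′ (V f0 n) (V f1 n) (W f0 n) (W f1 n)) D-vanishes)
      (vanishes-resp (λ n → cancel (V f1 n) (W f1 n)) ιZ0-vanishes)))
      where
      cancel : ∀ v₁ w₁ → w₁ * v₁ + - v₁ * w₁ ≡ + 0
      cancel = solve-∀
      minor′ : ∀ v₀ v₁ w₀ w₁ → w₁ * v₀ + - v₁ * w₀ ≡ v₀ * w₁ + - (v₁ * w₀)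
      minor′ = solve-∀
    trivial-combination : Vanishes (ιZ (+ 1)) × Vanishes (ιZ (+ 0))
    trivial-combination = vanishing-head⇒vanishing-coefficients (ιZ-coherent (+ 1)) (ιZ-coherent (+ 0))
      (vanishes-resp (λ n → pick (V f0 n) (W f0 n)) V₀-vanishes) (vanishes-resp (λ n → pick (V f1 n) (W f1 n)) V₁-vanishes)
      where
      pick : ∀ v w → + 1 * v + + 0 * w ≡ v
      pick = solve-∀

  -- At level N = 2(n + |d|) the plane gives 3^N ∣ D²·d, and 3^(|d|+1) ∤ d forces 3^n ∣ D.
  minorZ-vanishes : d ≢ + 0 → Vanishes minorZ
  minorZ-vanishes d≢0 = vanishing λ n → ∣-coherent-down minorZ-coherent (n≤N n) (three^n∣D[N] n)
    where
    minorZ-coherent : Coherent minorZ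
    minorZ-coherent = +Z-coherent (*Z-coherent (V-coherent f0) (W-coherent f1))
                                  (-Z-coherent (*Z-coherent (V-coherent f1) (W-coherent f0)))
    e : ℕ
    e = ℤ.∣ d ∣
    N : ℕ → ℕ
    N n = (n ℕ.+ e) ℕ.+ (n ℕ.+ e)
    n≤N : ∀ n → n ≤ N n
    n≤N n = ℕₚ.≤-trans (ℕₚ.m≤m+n n e) (ℕₚ.m≤m+n (n ℕ.+ e) (n ℕ.+ e))
    three^N∣D*[D*d] : ∀ n → three^ (N n) ∣ minorZ (N n) * (minorZ (N n) * d)
    three^N∣D*[D*d] n = subst (three^ (N n) ∣_) (ℤₚ.*-assoc (minorZ (N n)) (minorZ (N n)) d)
      (isotropic-plane-mod-three^ (n ℕ.+ e) d (b (N n)) (at (N n) V) (at (N n) W)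
        (λ s t → vanishes (isotropic (ιZ-coherent s) (ιZ-coherent t)) (N n)))
    three^n∣D[N] : ∀ n → three^ n ∣ minorZ (N n)
    three^n∣D[N] n with three^[i+j]∣x*y⇒three^i∣x⊎three^[1+j]∣y (n ℕ.+ e) (n ℕ.+ e) (three^N∣D*[D*d] n)
    ... | inj₁ three^[n+e]∣D = ∣-trans (three^-mono-∣ (ℕₚ.m≤m+n n e)) three^[n+e]∣D
    ... | inj₂ three^[1+n+e]∣D*d with three^[i+j]∣x*y⇒three^i∣x⊎three^[1+j]∣y (suc n) e three^[1+n+e]∣D*d
    ...   | inj₁ three^[1+n]∣D = ∣-trans (three^-mono-∣ (ℕₚ.n≤1+n n)) three^[1+n]∣D
    ...   | inj₂ three^[1+e]∣d = ⊥-elim (three^∣d∣∤d d≢0 (∣-trans (three^-mono-∣ (ℕₚ.n≤1+n e)) three^[1+e]∣d))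

no-integral-isotropic-plane : ∀ {d b} → d ≢ + 0 → ¬ IntegralIsotropicPlane d b
no-integral-isotropic-plane d≢0 plane = minorZ-not-vanishing plane (minorZ-vanishes plane d≢0)

bound : ∀ {n} → (Fin n → ℕ) → ℕ
bound {zero} f = 0
bound {suc n} f = f zero ℕ.⊔ bound (f ∘ suc)

≤-bound : ∀ {n} (f : Fin n → ℕ) i → f i ≤ bound f
≤-bound f zero = ℕₚ.m≤m⊔n (f zero) _
≤-bound f (suc i) = ℕₚ.≤-trans (≤-bound (f ∘ suc) i) (ℕₚ.m≤n⊔m (f zero) _)

module _ (d : ℤ) (b : Z3) (b-coh : IsZ3 b) where

  integral-isotropic-plane : ContainsRationalLine (Pencil d b) → IntegralIsotropicPlane d b
  integral-isotropic-plane (v , w , v-coh , w-coh , v,w-independent , on-quadric) = record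
    { V = V
    ; W = W
    ; V-coherent = V-coh
    ; W-coherent = W-coh
    ; isotropic = λ {S} {T} S-coh T-coh → ≅-vanishes
        (⟦⟧ℤ-coherent (pencil d) b-coherent (combination-coherent S-coh V-coh T-coh W-coh))
        (λ n → ⟦⟧-≅ (pencil d) b (λ i → line≅ S T i n))
        (on-quadric (ofZ3 S) (ofZ3 T) (Coherent⇒IsZ3 S-coh) (Coherent⇒IsZ3 T-coh))
    ; independent = λ {S} {T} S-coh T-coh vanishing →
        Product.map (≈0Q⇒vanishes (ofZ3 S)) (≈0Q⇒vanishes (ofZ3 T))
          (v,w-independent (ofZ3 S) (ofZ3 T) (Coherent⇒IsZ3 S-coh) (Coherent⇒IsZ3 T-coh) λ i →
            vanishes-≅ (Coherent⇒IsZ3 (line-coherent S-coh T-coh i)) (line≅ S T i) (vanishing i))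
    }
    where
    Eᵛ Eʷ E : ℕ
    Eᵛ = bound (exp ∘ v)
    Eʷ = bound (exp ∘ w)
    E = Eᵛ ℕ.⊔ Eʷ
    V W : Fin 5 → Z3
    V i = num (v i) *Z ιZ (three^ (E ℕ.∸ exp (v i)))
    W i = num (w i) *Z ιZ (three^ (E ℕ.∸ exp (w i)))
    b-coherent : Coherent b
    b-coherent = IsZ3⇒Coherent b-coh
    v-coherent : ∀ i → Coherent (num (v i))
    v-coherent i = IsZ3⇒Coherent (v-coh i)
    w-coherent : ∀ i → Coherent (num (w i))
    w-coherent i = IsZ3⇒Coherent (w-coh i)
    V-coh : ∀ i → Coherent (V i)
    V-coh i = *Z-coherent (v-coherent i) (ιZ-coherent (three^ (E ℕ.∸ exp (v i))))
    W-coh : ∀ i → Coherent (W i)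
    W-coh i = *Z-coherent (w-coherent i) (ιZ-coherent (three^ (E ℕ.∸ exp (w i))))
    line≅ : ∀ S T i n → lin (ofZ3 S) v (ofZ3 T) w i ≅[ n ] combination S V T W i n ÷3^ E
    line≅ S T i n =
      +Q-≅ (*Q-≅ (ofZ3-≅ S n) (≅-common-exponent (v i) (ℕₚ.≤-trans (≤-bound (exp ∘ v) i) (ℕₚ.m≤m⊔n Eᵛ Eʷ)) n))
           (*Q-≅ (ofZ3-≅ T n) (≅-common-exponent (w i) (ℕₚ.≤-trans (≤-bound (exp ∘ w) i) (ℕₚ.m≤n⊔m Eᵛ Eʷ)) n))
    line-coherent : ∀ {S T} → Coherent S → Coherent T → ∀ i → Coherent (num (lin (ofZ3 S) v (ofZ3 T) w i))
    line-coherent {S} {T} S-coh T-coh i =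
      +Q-coherent (ofZ3 S *Q v i) (ofZ3 T *Q w i) (*Z-coherent S-coh (v-coherent i)) (*Z-coherent T-coh (w-coherent i))

lemma1p3 : (d : ℤ) → d ≢ + 0 → (b : Z3) → IsZ3 b →
    ¬ ContainsRationalLine (Pencil d b)
lemma1p3 d d≢0 b b-coh = no-integral-isotropic-plane d≢0 ∘ integral-isotropic-plane d b b-coh
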